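{- Let $s,t$ be non-negative integers with $s+t>0$. Let $x_1,\ldots,x_s,y_1,\ldots,y_t$ be non-negative integers such that $\{x_1,\ldots,x_s,y_1,\ldots,y_t\}$ is an integer interval. Then \[ \frac{s}{s+t}\prod_{i=1}^s x_i\prod_{j=1}^t y_j+\frac{t}{s+t}\prod_{i=1}^s(x_i+1)\prod_{j=1}^t(y_j+1)\geq\prod_{i=1}^s x_i\prod_{j=1}^t(y_j+1). \]
   Context: An integer interval is a set of the form $\{z\in\mathbb{Z}\mid a\leq z\leq b\}$ for integers $a,b$. -}

module Defs where

open import Data.Nat using (ℕ; zero; suc; _+_; _*_; _≤_; _<_; >-nonZero)
open import Data.Fin using (Fin; zero; suc)
open import Data.Integer using (+_)
open import Data.Rational using (ℚ; _/_)
open import Data.Product using (∃; _×_; Σ)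
open import Data.Sum using (_⊎_)
open import Function.Bundles using (_⇔_)
open import Relation.Binary.PropositionalEquality using (_≡_)

prod : ∀ {n} → (Fin n → ℕ) → ℕ
prod {zero}  f = 1
prod {suc n} f = f zero * prod (λ i → f (suc i))

InValues : ∀ {s t} → (Fin s → ℕ) → (Fin t → ℕ) → ℕ → Set
InValues x y z = (∃ λ i → x i ≡ z) ⊎ (∃ λ j → y j ≡ z)

IsIntegerInterval : (ℕ → Set) → Set
IsIntegerInterval S = Σ ℕ λ a → Σ ℕ λ b → ∀ z → S z ⇔ (a ≤ z × z ≤ b)

frac : (m s t : ℕ) → 0 < s + t → ℚ
frac m s t h = (+ m) / (s + t)
  where instance _ = >-nonZero h

toℚ : ℕ → ℚ
toℚ n = (+ n) / 1

-- With X = ∏ xᵢ, X′ = ∏ (xᵢ + 1), Y = ∏ yⱼ and Y′ = ∏ (yⱼ + 1), the claim cleared of denominators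
-- is (s + t) X Y′ ≤ s X Y + t X′ Y′. It follows from X′/X ≥ (c + s)/c and Y′/Y ≤ c/(c − t) for a
-- single c > 0, and both are telescoping bounds on products of factors (z + 1)/z. To find c, scan all
-- the values in increasing order; as they fill an interval, each exceeds the previous one by at most
-- 1. Start with c the least value (or 1 if that is 0) and raise it by one whenever a y-value exceeds
-- c − 1 plus the number of x-values seen so far. Then an x-value met after i others is at most c + i
-- and every y-value is at least c − 1 when met, which is what the two telescoping bounds need.
module Submission where

open import Defs

module Gains where

  open import Data.Nat
  open import Data.Nat.Properties
  open import Data.Nat.ListAction using (product)
  open import Data.Nat.Tactic.RingSolver using (solve)
  open import Data.List using (List; []; _∷_; length; map)
  open import Relation.Binary.PropositionalEquality

  m≤n⇒m*[1+n]≤[1+m]*n : ∀ {m n} → m ≤ n → m * suc n ≤ suc m * n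
  m≤n⇒m*[1+n]≤[1+m]*n {m} {n} m≤n = begin
    m * suc n  ≡⟨ *-suc m n ⟩
    m + m * n  ≤⟨ +-monoˡ-≤ (m * n) m≤n ⟩
    n + m * n  ∎
    where open ≤-Reasoning

  gainAtLeast-step : ∀ {k z X d X′} → z ≤ k → k * X ≤ d * X′ → suc k * (z * X) ≤ d * (suc z * X′)
  gainAtLeast-step {k} {z} {X} {d} {X′} z≤k kX≤dX′ = begin
    suc k * (z * X)   ≡⟨ solve (k ∷ z ∷ X ∷ []) ⟩
    (z * suc k) * X   ≤⟨ *-monoˡ-≤ X (m≤n⇒m*[1+n]≤[1+m]*n z≤k) ⟩
    (suc z * k) * X   ≡⟨ *-assoc (suc z) k X ⟩
    suc z * (k * X)   ≤⟨ *-monoʳ-≤ (suc z) kX≤dX′ ⟩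
    suc z * (d * X′)  ≡⟨ solve (z ∷ d ∷ X′ ∷ []) ⟩
    d * (suc z * X′)  ∎
    where open ≤-Reasoning

  gainAtMost-step : ∀ {e z Y w Y′} → e ≤ z → w * Y′ ≤ e * Y → w * (suc z * Y′) ≤ suc e * (z * Y)
  gainAtMost-step {e} {z} {Y} {w} {Y′} e≤z wY′≤eY = begin
    w * (suc z * Y′)  ≡⟨ solve (w ∷ z ∷ Y′ ∷ []) ⟩
    suc z * (w * Y′)  ≤⟨ *-monoʳ-≤ (suc z) wY′≤eY ⟩
    suc z * (e * Y)   ≡⟨ solve (z ∷ e ∷ Y ∷ []) ⟩
    (e * suc z) * Y   ≤⟨ *-monoˡ-≤ Y (m≤n⇒m*[1+n]≤[1+m]*n e≤z) ⟩
    (suc e * z) * Y   ≡⟨ *-assoc (suc e) z Y ⟩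
    suc e * (z * Y)   ∎
    where open ≤-Reasoning

  -- In ratio form: X′/X ≥ 1 + s/c and Y/Y′ ≥ u/c ≥ 1 − t/c, so s Y/Y′ + t X′/X ≥ s + t.
  weightedMean-bound : ∀ {c u s t X X′ Y Y′} .{{_ : NonZero c}} → c ≤ t + u →
                        (c + s) * X ≤ c * X′ → u * Y′ ≤ c * Y →
                        (s + t) * (X * Y′) ≤ s * (X * Y) + t * (X′ * Y′)
  weightedMean-bound {c} {u} {s} {t} {X} {X′} {Y} {Y′} c≤t+u cX≤ uY′≤ = *-cancelˡ-≤ c (begin
    c * ((s + t) * (X * Y′))                ≡⟨ solve (c ∷ s ∷ t ∷ X ∷ Y′ ∷ []) ⟩
    s * X * (c * Y′) + t * Y′ * (c * X)      ≤⟨ +-monoˡ-≤ (t * Y′ * (c * X)) (*-monoʳ-≤ (s * X) (*-monoˡ-≤ Y′ c≤t+u)) ⟩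
    s * X * ((t + u) * Y′) + t * Y′ * (c * X) ≡⟨ solve (s ∷ X ∷ t ∷ u ∷ Y′ ∷ c ∷ []) ⟩
    s * X * (u * Y′) + t * Y′ * ((c + s) * X) ≤⟨ +-mono-≤ (*-monoʳ-≤ (s * X) uY′≤) (*-monoʳ-≤ (t * Y′) cX≤) ⟩
    s * X * (c * Y) + t * Y′ * (c * X′)      ≡⟨ solve (s ∷ X ∷ c ∷ Y ∷ t ∷ Y′ ∷ X′ ∷ []) ⟩
    c * (s * (X * Y) + t * (X′ * Y′))        ∎)
    where open ≤-Reasoning

  -- Cross-multiplied bounds on the gain ∏ (zᵢ + 1)/∏ zᵢ of a list: at least (d + length xs)/d for
  -- all d ≥ c, and at most d/(d − length ys) for all d ≤ c. Quantifying over d lets c change.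
  GainAtLeast : ℕ → List ℕ → Set
  GainAtLeast c xs = ∀ d → c ≤ d → (d + length xs) * product xs ≤ d * product (map suc xs)

  GainAtMost : ℕ → List ℕ → Set
  GainAtMost c ys = ∀ d → d ≤ c → (d ∸ length ys) * product (map suc ys) ≤ d * product ys

  gainAtLeast-[] : ∀ {c} → GainAtLeast c []
  gainAtLeast-[] d _ = ≤-reflexive (cong (_* 1) (+-identityʳ d))

  gainAtMost-[] : ∀ {c} → GainAtMost c []
  gainAtMost-[] d _ = ≤-refl

  gainAtLeast-mono : ∀ {c c′ xs} → c ≤ c′ → GainAtLeast c xs → GainAtLeast c′ xs
  gainAtLeast-mono c≤c′ gain d c′≤d = gain d (≤-trans c≤c′ c′≤d)

  gainAtLeast-∷ : ∀ {c z xs} → z ≤ c + length xs → GainAtLeast c xs → GainAtLeast c (z ∷ xs)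
  gainAtLeast-∷ {xs = xs} z≤c+s gain d c≤d rewrite +-suc d (length xs) =
    gainAtLeast-step {d = d} (≤-trans z≤c+s (+-monoˡ-≤ (length xs) c≤d)) (gain d c≤d)

  gainAtMost-∷ : ∀ {c c′ z ys} → c′ ≤ suc c → c′ ≤ suc z → GainAtMost c ys → GainAtMost c′ (z ∷ ys)
  gainAtMost-∷ _ _ _ zero _ = z≤n
  gainAtMost-∷ {ys = ys} c′≤c+1 c′≤z+1 gain (suc e) e<c′ =
    gainAtMost-step {w = e ∸ length ys} (≤-pred (≤-trans e<c′ c′≤z+1)) (gain e (≤-pred (≤-trans e<c′ c′≤c+1)))

module MergedValues where

  open import Data.Nat
  open import Data.Nat.Properties
  open import Data.Nat.ListAction using (product)
  open import Data.Nat.ListAction.Properties using (product-↭)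
  open import Data.Fin as Fin using (Fin)
  open import Data.List using (List; []; _∷_; _++_; _ʳ++_; length; map; mapMaybe; tabulate)
  open import Data.List.Properties
    using (mapMaybe-++; mapMaybeIsInj₁∘mapInj₁; mapMaybeIsInj₁∘mapInj₂; mapMaybeIsInj₂∘mapInj₁; mapMaybeIsInj₂∘mapInj₂;
           ++-identityʳ; length-tabulate; map-tabulate)
  open import Data.List.Relation.Unary.All as All using (All; []; _∷_; lookupAny)
  import Data.List.Relation.Unary.All.Properties as Allₚ
  open import Data.List.Relation.Unary.Any using (Any; here; there)
  import Data.List.Relation.Unary.Any.Properties as Anyₚ
  open import Data.List.Relation.Unary.AllPairs using (AllPairs; []; _∷_)
  open import Data.List.Relation.Unary.Linked.Properties using (Linked⇒AllPairs)
  open import Data.List.Relation.Binary.Permutation.Propositional using (_↭_; ↭-sym; ↭-trans; ↭-reflexive)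
  open import Data.List.Relation.Binary.Permutation.Propositional.Properties
    using (All-resp-↭; Any-resp-↭; ↭-length; ↭-reverse; mapMaybe-↭)
    renaming (map⁺ to map-↭)
  open import Data.Product using (∃-syntax; _×_; _,_; proj₁; proj₂)
  open import Data.Maybe using (Maybe)
  open import Data.Sum using (_⊎_; inj₁; inj₂; reduce; isInj₁; isInj₂)
  open import Function using (_∘_; Equivalence)
  open import Relation.Binary.Bundles using (DecTotalOrder)
  import Relation.Binary.Construct.On as On
  open import Relation.Binary.PropositionalEquality
  open import Relation.Nullary using (yes; no; contradiction)
  open Gains

  -- inj₁ z records a value z of the xᵢ, inj₂ z a value z of the yⱼ
  Entry : Set
  Entry = ℕ ⊎ ℕ

  value : Entry → ℕ
  value = reduce

  entryOrder : DecTotalOrder _ _ _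
  entryOrder = On.decTotalOrder ≤-decTotalOrder value

  open import Data.List.Sort entryOrder using (sort; sort-↭; sort-↗)

  xValues yValues : List Entry → List ℕ
  xValues = mapMaybe isInj₁
  yValues = mapMaybe isInj₂

  data UnitSteps : ℕ → List Entry → Set where
    []  : ∀ {b} → UnitSteps b []
    _∷_ : ∀ {b e S} → b ≤ value e × value e ≤ suc b → UnitSteps (value e) S → UnitSteps b (e ∷ S)

  GapFreeAbove : ℕ → List Entry → Set
  GapFreeAbove b S = ∀ v → b < v → Any (λ e → v ≤ value e) S → Any (λ e → value e ≡ v) S

  gapFree⇒unitSteps : ∀ {b S} → AllPairs (λ e f → value e ≤ value f) S → All (λ e → b ≤ value e) S →
                      GapFreeAbove b S → UnitSteps b S
  gapFree⇒unitSteps [] [] _ = []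
  gapFree⇒unitSteps {b} {e ∷ S} (e≤S ∷ sorted) (b≤e ∷ _) gapFree =
    (b≤e , e≤b+1) ∷ gapFree⇒unitSteps sorted e≤S gapFree-S
    where
    e≤b+1 : value e ≤ suc b
    e≤b+1 with ≤-total (value e) (suc b)
    ... | inj₁ e≤b+1 = e≤b+1
    ... | inj₂ b+1≤e =
      let e≤f , f≡b+1 = lookupAny (≤-refl ∷ e≤S) (gapFree (suc b) (n<1+n b) (here b+1≤e))
      in ≤-trans e≤f (≤-reflexive f≡b+1)
    gapFree-S : GapFreeAbove (value e) S
    gapFree-S v e<v v≤S with gapFree v (≤-<-trans b≤e e<v) (there v≤S)
    ... | here e≡v = contradiction e≡v (<⇒≢ e<v)
    ... | there S∋v = S∋v

  -- suc k is the current c, b the value scanned last, and xs, ys the values scanned so far.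
  unitSteps⇒gainBounds : ∀ {b k} S xs ys → UnitSteps b S → k ≤ b → b ≤ k + length xs →
                         GainAtLeast (suc k) xs → GainAtMost (suc k) ys →
                         ∃[ k′ ] GainAtLeast (suc k′) (xValues S ʳ++ xs) × GainAtMost (suc k′) (yValues S ʳ++ ys)
  unitSteps⇒gainBounds [] xs ys [] _ _ gainX gainY = _ , gainX , gainY
  unitSteps⇒gainBounds {b} {k} (inj₁ z ∷ S) xs ys ((b≤z , z≤b+1) ∷ steps) k≤b b≤k+s gainX gainY =
    unitSteps⇒gainBounds S (z ∷ xs) ys steps (≤-trans k≤b b≤z) (≤-trans z≤k+s+1 (≤-reflexive (sym (+-suc k _))))
      (gainAtLeast-∷ {xs = xs} z≤k+s+1 gainX) gainY
    where
    z≤k+s+1 : z ≤ suc (k + length xs)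
    z≤k+s+1 = ≤-trans z≤b+1 (s≤s b≤k+s)
  unitSteps⇒gainBounds {b} {k} (inj₂ z ∷ S) xs ys ((b≤z , z≤b+1) ∷ steps) k≤b b≤k+s gainX gainY
    with z ≤? k + length xs
  ... | yes z≤k+s =
    unitSteps⇒gainBounds S xs (z ∷ ys) steps (≤-trans k≤b b≤z) z≤k+s
      gainX (gainAtMost-∷ {ys = ys} (n≤1+n _) (s≤s (≤-trans k≤b b≤z)) gainY)
  ... | no z≰k+s =
    unitSteps⇒gainBounds S xs (z ∷ ys) steps k<z (≤-trans z≤b+1 (s≤s b≤k+s))
      (gainAtLeast-mono {xs = xs} (n≤1+n _) gainX) (gainAtMost-∷ {ys = ys} ≤-refl (s≤s k<z) gainY)
    where
    k<z : k < z
    k<z = ≤-trans (s≤s (m≤m+n k (length xs))) (≰⇒> z≰k+s)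

  module _ {s t} (x : Fin s → ℕ) (y : Fin t → ℕ) where

    entries : List Entry
    entries = map inj₁ (tabulate x) ++ map inj₂ (tabulate y)

    xValues-entries : xValues entries ≡ tabulate x
    xValues-entries = begin
      xValues entries
        ≡⟨ mapMaybe-++ isInj₁ (map inj₁ (tabulate x)) _ ⟩
      xValues (map inj₁ (tabulate x)) ++ xValues (map inj₂ (tabulate y))
        ≡⟨ cong₂ _++_ (mapMaybeIsInj₁∘mapInj₁ (tabulate x)) (mapMaybeIsInj₁∘mapInj₂ (tabulate y)) ⟩
      tabulate x ++ []
        ≡⟨ ++-identityʳ _ ⟩
      tabulate x
        ∎
      where open ≡-Reasoning

    yValues-entries : yValues entries ≡ tabulate y
    yValues-entries = begin
      yValues entries
        ≡⟨ mapMaybe-++ isInj₂ (map inj₁ (tabulate x)) _ ⟩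
      yValues (map inj₁ (tabulate x)) ++ yValues (map inj₂ (tabulate y))
        ≡⟨ cong₂ _++_ (mapMaybeIsInj₂∘mapInj₁ (tabulate x)) (mapMaybeIsInj₂∘mapInj₂ (tabulate y)) ⟩
      tabulate y
        ∎
      where open ≡-Reasoning

    entries-inValues : All (InValues x y ∘ value) entries
    entries-inValues = Allₚ.++⁺ (Allₚ.map⁺ (Allₚ.tabulate⁺ λ i → inj₁ (i , refl)))
                               (Allₚ.map⁺ (Allₚ.tabulate⁺ λ j → inj₂ (j , refl)))

    inValues-entries : ∀ {v} → InValues x y v → Any (λ e → value e ≡ v) entries
    inValues-entries (inj₁ (i , xᵢ≡v)) = Anyₚ.++⁺ˡ (Anyₚ.map⁺ (Anyₚ.tabulate⁺ i xᵢ≡v))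
    inValues-entries (inj₂ (j , yⱼ≡v)) = Anyₚ.++⁺ʳ (map inj₁ (tabulate x)) (Anyₚ.map⁺ (Anyₚ.tabulate⁺ j yⱼ≡v))

    interval⇒unitSteps : IsIntegerInterval (InValues x y) → ∃[ b ] UnitSteps b (sort entries)
    interval⇒unitSteps (a , b , interval) =
      a ∸ 1 , gapFree⇒unitSteps (Linked⇒AllPairs ≤-trans (sort-↗ entries)) above gapFree
      where
      sorted↭ : sort entries ↭ entries
      sorted↭ = sort-↭ entries
      inValues : All (InValues x y ∘ value) (sort entries)
      inValues = All-resp-↭ (↭-sym sorted↭) entries-inValues
      above : All (λ e → a ∸ 1 ≤ value e) (sort entries)
      above = All.map (λ inV → ≤-trans (m∸n≤m a 1) (proj₁ (Equivalence.to (interval _) inV))) inValues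
      gapFree : GapFreeAbove (a ∸ 1) (sort entries)
      gapFree v a-1<v v≤S =
        let inV , v≤e = lookupAny inValues v≤S
            a≤v = ≤-trans (m≤n+m∸n a 1) a-1<v
            v≤b = ≤-trans v≤e (proj₂ (Equivalence.to (interval _) inV))
        in Any-resp-↭ (↭-sym sorted↭) (inValues-entries (Equivalence.from (interval v) (a≤v , v≤b)))

    sortedValues↭ : ∀ {zs} (p : Entry → Maybe ℕ) → mapMaybe p entries ≡ zs → mapMaybe p (sort entries) ʳ++ [] ↭ zs
    sortedValues↭ p eq = ↭-trans (↭-reverse _) (↭-trans (mapMaybe-↭ p (sort-↭ entries)) (↭-reflexive eq))

  prod≡product∘tabulate : ∀ {n} (f : Fin n → ℕ) → prod f ≡ product (tabulate f)
  prod≡product∘tabulate {zero}  f = refl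
  prod≡product∘tabulate {suc n} f = cong (f Fin.zero *_) (prod≡product∘tabulate (f ∘ Fin.suc))

  module _ {n} (f : Fin n → ℕ) {zs} (zs↭f : zs ↭ tabulate f) where

    length-↭-tabulate : length zs ≡ n
    length-↭-tabulate = trans (↭-length zs↭f) (length-tabulate f)

    product-↭-tabulate : product zs ≡ prod f
    product-↭-tabulate = trans (product-↭ zs↭f) (sym (prod≡product∘tabulate f))

    product-suc-↭-tabulate : product (map suc zs) ≡ prod (suc ∘ f)
    product-suc-↭-tabulate = begin
      product (map suc zs)           ≡⟨ product-↭ (map-↭ suc zs↭f) ⟩
      product (map suc (tabulate f)) ≡⟨ cong product (map-tabulate f suc) ⟩
      product (tabulate (suc ∘ f))   ≡⟨ prod≡product∘tabulate (suc ∘ f) ⟨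
      prod (suc ∘ f)                 ∎
      where open ≡-Reasoning

    gainAtLeast-tabulate : ∀ {c} → GainAtLeast c zs → (c + n) * prod f ≤ c * prod (suc ∘ f)
    gainAtLeast-tabulate {c} gain =
      subst₂ _≤_ (cong₂ (λ m P → (c + m) * P) length-↭-tabulate product-↭-tabulate)
                 (cong (c *_) product-suc-↭-tabulate) (gain c ≤-refl)

    gainAtMost-tabulate : ∀ {c} → GainAtMost c zs → (c ∸ n) * prod (suc ∘ f) ≤ c * prod f
    gainAtMost-tabulate {c} gain =
      subst₂ _≤_ (cong₂ (λ m P → (c ∸ m) * P) length-↭-tabulate product-suc-↭-tabulate)
                 (cong (c *_) product-↭-tabulate) (gain c ≤-refl)

  gainBounds : ∀ {s t} (x : Fin s → ℕ) (y : Fin t → ℕ) → IsIntegerInterval (InValues x y) →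
               ∃[ k ] (suc k + s) * prod x ≤ suc k * prod (suc ∘ x) × (suc k ∸ t) * prod (suc ∘ y) ≤ suc k * prod y
  gainBounds x y interval =
    let b , steps = interval⇒unitSteps x y interval
        k , gainX , gainY = unitSteps⇒gainBounds _ [] [] steps ≤-refl (m≤m+n b 0) gainAtLeast-[] gainAtMost-[]
    in k , gainAtLeast-tabulate x (sortedValues↭ x y isInj₁ (xValues-entries x y)) gainX
         , gainAtMost-tabulate y (sortedValues↭ x y isInj₂ (yValues-entries x y)) gainY

module RationalMean where

  open import Data.Nat using (suc; _+_; _*_; _≤_; NonZero)
  import Data.Nat.Properties as ℕ
  open import Data.Nat.Tactic.RingSolver using (solve)
  open import Data.Integer as ℤ using (+_; +≤+)
  import Data.Integer.Properties as ℤ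
  open import Data.Rational as ℚ using (_/_; toℚᵘ)
  import Data.Rational.Properties as ℚ
  open import Data.Rational.Unnormalised as ℚᵘ using (mkℚᵘ; *≤*)
  import Data.Rational.Unnormalised.Properties as ℚᵘ
  open import Data.List using ([]; _∷_)
  open import Relation.Binary.PropositionalEquality

  crossMultiplied-mean-≤ : ∀ {s t A B C} m → m * C ≤ s * A + t * B →
    + C ℤ.* + (m * m) ℤ.≤ ((+ s ℤ.* + A) ℤ.* + m ℤ.+ (+ t ℤ.* + B) ℤ.* + m) ℤ.* + 1
  crossMultiplied-mean-≤ {s} {t} {A} {B} {C} m mC≤sA+tB = begin
    + C ℤ.* + (m * m)                                          ≡⟨ ℤ.pos-* C (m * m) ⟨
    + (C * (m * m))                                            ≡⟨ cong +_ (solve (C ∷ m ∷ [])) ⟩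
    + (m * C * m)                                              ≤⟨ +≤+ (ℕ.*-monoˡ-≤ m mC≤sA+tB) ⟩
    + ((s * A + t * B) * m)                                    ≡⟨ ℤ.pos-* (s * A + t * B) m ⟩
    (+ (s * A) ℤ.+ + (t * B)) ℤ.* + m                          ≡⟨ cong₂ (λ u v → (u ℤ.+ v) ℤ.* + m) (ℤ.pos-* s A) (ℤ.pos-* t B) ⟩
    (+ s ℤ.* + A ℤ.+ + t ℤ.* + B) ℤ.* + m                      ≡⟨ ℤ.*-distribʳ-+ (+ m) (+ s ℤ.* + A) (+ t ℤ.* + B) ⟩
    (+ s ℤ.* + A) ℤ.* + m ℤ.+ (+ t ℤ.* + B) ℤ.* + m            ≡⟨ ℤ.*-identityʳ _ ⟨
    ((+ s ℤ.* + A) ℤ.* + m ℤ.+ (+ t ℤ.* + B) ℤ.* + m) ℤ.* + 1  ∎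
    where open ℤ.≤-Reasoning

  toℚ-≤-weightedMean : ∀ s t n .{{_ : NonZero n}} {A B C} → n * C ≤ s * A + t * B →
                       toℚ C ℚ.≤ (+ s / n) ℚ.* toℚ A ℚ.+ (+ t / n) ℚ.* toℚ B
  toℚ-≤-weightedMean s t (suc k) {A} {B} {C} nC≤sA+tB =
    ℚ.toℚᵘ-cancel-≤ (ℚᵘ.≤-respˡ-≃ (ℚᵘ.≃-sym (ℚ.toℚᵘ-fromℚᵘ (mkℚᵘ (+ C) 0)))
                      (ℚᵘ.≤-respʳ-≃ (ℚᵘ.≃-sym mean≃) (*≤* (crossMultiplied-mean-≤ {s} {t} {A} {B} (suc (k * 1)) mC≤sA+tB))))
    where
    term≃ : ∀ m M → toℚᵘ ((+ m / suc k) ℚ.* toℚ M) ℚᵘ.≃ mkℚᵘ (+ m) k ℚᵘ.* mkℚᵘ (+ M) 0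
    term≃ m M = ℚᵘ.≃-trans (ℚ.toℚᵘ-homo-* (+ m / suc k) (toℚ M))
                           (ℚᵘ.*-cong (ℚ.toℚᵘ-fromℚᵘ (mkℚᵘ (+ m) k)) (ℚ.toℚᵘ-fromℚᵘ (mkℚᵘ (+ M) 0)))
    mean≃ : toℚᵘ ((+ s / suc k) ℚ.* toℚ A ℚ.+ (+ t / suc k) ℚ.* toℚ B) ℚᵘ.≃
            mkℚᵘ (+ s) k ℚᵘ.* mkℚᵘ (+ A) 0 ℚᵘ.+ mkℚᵘ (+ t) k ℚᵘ.* mkℚᵘ (+ B) 0
    mean≃ = ℚᵘ.≃-trans (ℚ.toℚᵘ-homo-+ ((+ s / suc k) ℚ.* toℚ A) ((+ t / suc k) ℚ.* toℚ B))
                       (ℚᵘ.+-cong (term≃ s A) (term≃ t B))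
    mC≤sA+tB : suc (k * 1) * C ≤ s * A + t * B
    mC≤sA+tB = subst (λ m → m * C ≤ s * A + t * B) (cong suc (sym (ℕ.*-identityʳ k))) nC≤sA+tB

open import Data.Nat using (ℕ; _+_; _<_; suc) renaming (_*_ to _*ℕ_)
open import Data.Fin using (Fin)
open import Data.Rational using (ℚ; _≤_; _*_) renaming (_+_ to _+ℚ_)

open import Data.Nat using (_∸_; >-nonZero)
open import Data.Nat.Properties using (m≤n+m∸n)
open import Data.Product using (_,_)
open Gains using (weightedMean-bound)
open MergedValues using (gainBounds)
open RationalMean using (toℚ-≤-weightedMean)

lemmaA1 : (s t : ℕ) → (h : 0 < s + t) →
    (x : Fin s → ℕ) → (y : Fin t → ℕ) →
    IsIntegerInterval (InValues x y) →
    toℚ (prod x *ℕ prod (λ j → suc (y j))) ≤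
      (frac s s t h * toℚ (prod x *ℕ prod y) +ℚ
        frac t s t h * toℚ (prod (λ i → suc (x i)) *ℕ prod (λ j → suc (y j))))
lemmaA1 s t h x y interval with gainBounds x y interval
... | k , gainX , gainY =
  toℚ-≤-weightedMean s t (s + t) {{>-nonZero h}}
    (weightedMean-bound {c = suc k} {u = suc k ∸ t} (m≤n+m∸n (suc k) t) gainX gainY)
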